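{- Let $M\models\textup{DOAG}$ and let $A\subseteq M$ be a $\mathbb{Q}$-vector subspace such that $M$ is $|A|^+$-saturated and strongly $|A|^+$-homogeneous. Let $a\in A$ and $d\in M$. Then the following are equivalent: (1) $d-a\in G(d/A)$ and $d\notin A$; (2) $\Delta(d-a)\notin\Delta(A)$.
   Context: $\Delta$ is the Archimedean valuation: $\Delta(x)\le\Delta(y)$ iff $x\in[-n|y|,n|y|]$ for some $n<\omega$, and $\Delta(x)$ is the class of $x$ for the associated equivalence; $\Delta(A)=\{\Delta(a):a\in A\}$. $\textup{ct}(d/A)$ is the intersection of all intervals containing $d$ with endpoints in $A\cup\{\pm\infty\}$; $\textup{Stab}(d/A)=\{x\in A:\textup{ct}(d+x/A)=\textup{ct}(d/A)\}$; if $d\notin A$, $G(d/A)=\bigcap\{\,]-|x|,|x|[\,:x\in A\setminus\textup{Stab}(d/A)\}$, and $G(d/A)=\{0\}$ if $d\in A$. -}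

module Defs where

open import Data.Nat using (ℕ; zero; suc)
open import Data.Fin using (Fin)
open import Data.Vec using (Vec; []; _∷_; lookup)
open import Data.List using (List)
open import Data.List.Relation.Unary.All using (All)
open import Data.Product using (Σ; ∃; _×_; _,_; proj₁)
open import Data.Sum using (_⊎_; inj₁; inj₂)
open import Data.Empty using (⊥)
open import Data.Unit using (⊤)
open import Relation.Nullary using (¬_)
open import Relation.Binary.PropositionalEquality using (_≡_)
open import Function.Bundles using (_⇔_)

natMul : {C : Set} → C → (C → C → C) → ℕ → C → C
natMul z p zero    x = z
natMul z p (suc n) x = p x (natMul z p n x)

record DOAG : Set₁ where
  infixl 6 _+_
  infix 8 -_
  infix 4 _<_
  field
    Carrier : Set
    0#      : Carrier
    _+_     : Carrier → Carrier → Carrier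
    -_      : Carrier → Carrier
    _<_     : Carrier → Carrier → Set
    +-assoc     : ∀ x y z → (x + y) + z ≡ x + (y + z)
    +-comm      : ∀ x y → x + y ≡ y + x
    +-identityʳ : ∀ x → x + 0# ≡ x
    +-inverseʳ  : ∀ x → x + (- x) ≡ 0#
    <-irrefl    : ∀ x → ¬ (x < x)
    <-trans     : ∀ x y z → x < y → y < z → x < z
    <-tri       : ∀ x y → (x < y) ⊎ ((x ≡ y) ⊎ (y < x))
    <-+-compat  : ∀ x y z → x < y → x + z < y + z
    divisible   : ∀ (n : ℕ) (x : Carrier) → ∃ λ y → natMul 0# _+_ (suc n) y ≡ x
    nontrivial  : ∃ λ (x : Carrier) → ¬ (x ≡ 0#)

module DOAGDefs (M : DOAG) where
  open DOAG M

  _•_ : ℕ → Carrier → Carrier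
  _•_ = natMul 0# _+_

  infixl 6 _-_
  infix 4 _≤_
  infixr 7 _•_

  _-_ : Carrier → Carrier → Carrier
  x - y = x + (- y)

  _≤_ : Carrier → Carrier → Set
  x ≤ y = (x < y) ⊎ (x ≡ y)

  ∣_∣ : Carrier → Carrier
  ∣ x ∣ with <-tri 0# x
  ... | inj₁ _        = x
  ... | inj₂ (inj₁ _) = x
  ... | inj₂ (inj₂ _) = - x

  Subset : Set₁
  Subset = Carrier → Set

  record IsQSubspace (A : Subset) : Set where
    field
      zero-mem : A 0#
      +-mem    : ∀ x y → A x → A y → A (x + y)
      neg-mem  : ∀ x → A x → A (- x)
      div-mem  : ∀ (n : ℕ) y → A (suc n • y) → A y

  -- Δ(x) ≤ Δ(y)  iff  x ∈ [-n|y|, n|y|] for some n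
  _≼Δ_ : Carrier → Carrier → Set
  x ≼Δ y = ∃ λ (n : ℕ) → (- (n • ∣ y ∣) ≤ x) × (x ≤ n • ∣ y ∣)

  _≈Δ_ : Carrier → Carrier → Set
  x ≈Δ y = (x ≼Δ y) × (y ≼Δ x)

  Δ∈Δ : Carrier → Subset → Set
  Δ∈Δ x A = ∃ λ a → A a × (x ≈Δ a)

  data LowerEnd (A : Subset) : Set where
    -∞      : LowerEnd A
    open-lo   : (a : Carrier) → A a → LowerEnd A
    closed-lo : (a : Carrier) → A a → LowerEnd A

  data UpperEnd (A : Subset) : Set where
    +∞      : UpperEnd A
    open-hi   : (a : Carrier) → A a → UpperEnd A
    closed-hi : (a : Carrier) → A a → UpperEnd A

  aboveLo : ∀ {A} → LowerEnd A → Carrier → Set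
  aboveLo -∞              x = ⊤
  aboveLo (open-lo a _)   x = a < x
  aboveLo (closed-lo a _) x = a ≤ x

  belowHi : ∀ {A} → UpperEnd A → Carrier → Set
  belowHi +∞              x = ⊤
  belowHi (open-hi a _)   x = x < a
  belowHi (closed-hi a _) x = x ≤ a

  Interval : Subset → Set
  Interval A = LowerEnd A × UpperEnd A

  _∈I_ : ∀ {A} → Carrier → Interval A → Set
  x ∈I (l , u) = aboveLo l x × belowHi u x

  ct : Carrier → Subset → Subset
  ct d A x = ∀ (I : Interval A) → d ∈I I → x ∈I I

  _≐_ : Subset → Subset → Set
  S ≐ T = ∀ x → S x ⇔ T x

  Stab : Carrier → Subset → Subset
  Stab d A x = A x × (ct (d + x) A ≐ ct d A)

  G : Carrier → Subset → Subset
  G d A y = (A d → y ≡ 0#)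
          × (¬ A d → ∀ x → A x → ¬ Stab d A x → (- ∣ x ∣ < y) × (y < ∣ x ∣))

  data Term (P : Set) (n : ℕ) : Set where
    var   : Fin n → Term P n
    par   : P → Term P n
    zeroT : Term P n
    plusT : Term P n → Term P n → Term P n
    negT  : Term P n → Term P n

  data Formula (P : Set) : ℕ → Set where
    eqF  : ∀ {n} → Term P n → Term P n → Formula P n
    ltF  : ∀ {n} → Term P n → Term P n → Formula P n
    notF : ∀ {n} → Formula P n → Formula P n
    andF : ∀ {n} → Formula P n → Formula P n → Formula P n
    exF  : ∀ {n} → Formula P (suc n) → Formula P n

  evalT : ∀ {P n} → (P → Carrier) → Vec Carrier n → Term P n → Carrier
  evalT ρ env (var i)     = lookup env i
  evalT ρ env (par p)     = ρ p
  evalT ρ env zeroT       = 0#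
  evalT ρ env (plusT s t) = evalT ρ env s + evalT ρ env t
  evalT ρ env (negT t)    = - evalT ρ env t

  Sat : ∀ {P n} → (P → Carrier) → Vec Carrier n → Formula P n → Set
  Sat ρ env (eqF s t)  = evalT ρ env s ≡ evalT ρ env t
  Sat ρ env (ltF s t)  = evalT ρ env s < evalT ρ env t
  Sat ρ env (notF φ)   = ¬ Sat ρ env φ
  Sat ρ env (andF φ ψ) = Sat ρ env φ × Sat ρ env ψ
  Sat ρ env (exF φ)    = Σ Carrier λ x → Sat ρ (x ∷ env) φ

  Par : Subset → Set
  Par B = Σ Carrier B

  -- |B| ≤ |A|  (i.e. |B| < |A|⁺): an injection B → A
  CardLe : Subset → Subset → Set
  CardLe B A = Σ (∀ x → B x → Carrier) λ f →
                 (∀ x p → A (f x p)) × (∀ x y p q → f x p ≡ f y q → x ≡ y)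

  -- A (partial) 1-type over B, consistent with Th(M_B), i.e. finitely
  -- satisfiable in M
  FinSat : ∀ {B} → (Formula (Par B) 1 → Set) → Set
  FinSat {B} p = ∀ (l : List (Formula (Par B) 1)) → All p l →
                   ∃ λ x → All (Sat proj₁ (x ∷ [])) l

  Realized : ∀ {B} → (Formula (Par B) 1 → Set) → Set
  Realized {B} p = ∃ λ x → ∀ φ → p φ → Sat proj₁ (x ∷ []) φ

  Saturated⁺ : Subset → Set₁
  Saturated⁺ A = ∀ (B : Subset) → CardLe B A →
                   ∀ (p : Formula (Par B) 1 → Set) → FinSat p → Realized p

  Elementary : ∀ {B} → (Par B → Carrier) → Set
  Elementary {B} f = ∀ (φ : Formula (Par B) 0) → Sat proj₁ [] φ ⇔ Sat f [] φ

  record Automorphism : Set where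
    field
      σ       : Carrier → Carrier
      σ⁻¹     : Carrier → Carrier
      inv₁    : ∀ x → σ (σ⁻¹ x) ≡ x
      inv₂    : ∀ x → σ⁻¹ (σ x) ≡ x
      pres-0  : σ 0# ≡ 0#
      pres-+  : ∀ x y → σ (x + y) ≡ σ x + σ y
      pres--  : ∀ x → σ (- x) ≡ - σ x
      pres-<  : ∀ x y → (x < y) ⇔ (σ x < σ y)

  StronglyHomogeneous⁺ : Subset → Set₁
  StronglyHomogeneous⁺ A = ∀ (B : Subset) → CardLe B A →
    ∀ (f : Par B → Carrier) → Elementary f →
    Σ Automorphism λ τ → ∀ b (p : B b) → Automorphism.σ τ b ≡ f (b , p)

-- Write e = d - a.
-- (2) ⇒ (1): if x ∈ A and |x| ≤ |e|, then 2|x| < |e| because Δ(e) ∉ Δ(A). An element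
-- c ∈ A between d and d + x would satisfy 2|d - c| < |e|, hence Δ(c - a) = Δ(e); so d and
-- d + x lie in the same cut over A, i.e. x ∈ Stab(d/A). Thus every x ∈ A outside
-- Stab(d/A) has |x| > |e|, which is e ∈ G(d/A); and d ∉ A since otherwise e ∈ A.
-- (1) ⇒ (2): if Δ(e) = Δ(b) with b ∈ A, dividing |b| gives y ∈ A with 0 ≤ y ≤ |e| ≤ K y.
-- By (1), ±y ∈ Stab(d/A), so the cut of d is invariant under translation by y; starting
-- from a and translating K times towards d pins d down to a ± K y ∈ A.

module Submission where

open import Defs
open import Data.Product using (_×_)
open import Relation.Nullary using (¬_)
open import Function.Bundles using (_⇔_)

open import Algebra.Bundles using (AbelianGroup)
open import Algebra.Structures using (IsAbelianGroup)
import Algebra.Properties.AbelianGroup as AbelianGroupProperties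
open import Data.Empty using (⊥; ⊥-elim)
open import Data.Nat as ℕ using (ℕ; zero; suc)
open import Data.Product using (_,_; proj₁; proj₂; swap)
open import Data.Sum using (_⊎_; inj₁; inj₂) renaming (swap to ⊎-swap)
open import Function.Base using (_∘_)
open import Data.Unit using (tt)
open import Function.Bundles using (mk⇔; Equivalence)
open import Relation.Binary.Bundles using (StrictPartialOrder)
import Relation.Binary.Properties.StrictPartialOrder as StrictPartialOrderProperties
import Relation.Binary.Reasoning.StrictPartialOrder
open import Relation.Binary.PropositionalEquality

module DOAGProperties (M : DOAG) where
  open DOAG M
  open DOAGDefs M

  +-identityˡ : ∀ x → 0# + x ≡ x
  +-identityˡ x = trans (+-comm 0# x) (+-identityʳ x)

  +-isAbelianGroup : IsAbelianGroup _≡_ _+_ 0# (-_)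
  +-isAbelianGroup = record
    { isGroup = record
      { isMonoid = record
        { isSemigroup = record
          { isMagma = record { isEquivalence = isEquivalence ; ∙-cong = cong₂ _+_ }
          ; assoc = +-assoc }
        ; identity = +-identityˡ , +-identityʳ }
      ; inverse = (λ x → trans (+-comm (- x) x) (+-inverseʳ x)) , +-inverseʳ
      ; ⁻¹-cong = cong (-_) }
    ; comm = +-comm }

  +-abelianGroup : AbelianGroup _ _
  +-abelianGroup = record { isAbelianGroup = +-isAbelianGroup }

  open AbelianGroupProperties +-abelianGroup public
    using (\\-leftDividesˡ; \\-leftDividesʳ; //-rightDividesˡ; //-rightDividesʳ)
    renaming ( ε⁻¹≈ε to -0#≡0#; ⁻¹-involutive to -‿involutive
             ; ⁻¹-∙-comm to -‿+-comm; ⁻¹-anti-homo‿- to -‿anti-homo‿-)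

  x+[y-x]≡y : ∀ x y → x + (y - x) ≡ y
  x+[y-x]≡y x y = trans (+-comm x (y - x)) (//-rightDividesˡ x y)

  [x-y]+[y-z]≡x-z : ∀ x y z → (x - y) + (y - z) ≡ x - z
  [x-y]+[y-z]≡x-z x y z = begin
    (x - y) + (y - z)  ≡⟨ +-assoc x (- y) (y - z) ⟩
    x + (- y + (y - z)) ≡⟨ cong (x +_) (\\-leftDividesʳ y (- z)) ⟩
    x - z               ∎
    where open ≡-Reasoning

  x-[x+y]≡-y : ∀ x y → x - (x + y) ≡ - y
  x-[x+y]≡-y x y = trans (cong (x +_) (sym (-‿+-comm x y))) (\\-leftDividesˡ x (- y))

  -- Order

  <-strictPartialOrder : StrictPartialOrder _ _ _
  <-strictPartialOrder = record
    { isStrictPartialOrder = record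
      { isEquivalence = isEquivalence
      ; irrefl = λ { refl → <-irrefl _ }
      ; trans = <-trans _ _ _
      ; <-resp-≈ = resp₂ _<_ } }

  module ≤-Reasoning = Relation.Binary.Reasoning.StrictPartialOrder <-strictPartialOrder

  open StrictPartialOrderProperties <-strictPartialOrder public
    using () renaming (refl to ≤-refl; trans to ≤-trans; antisym to ≤-antisym)

  ≤-<-trans : ∀ {x y z} → x ≤ y → y < z → x < z
  ≤-<-trans (inj₁ x<y) y<z = <-trans _ _ _ x<y y<z
  ≤-<-trans (inj₂ refl) y<z = y<z

  ≤⇒≯ : ∀ {x y} → x ≤ y → ¬ y < x
  ≤⇒≯ x≤y y<x = <-irrefl _ (≤-<-trans x≤y y<x)

  ≰⇒> : ∀ {x y} → ¬ x ≤ y → y < x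
  ≰⇒> {x} {y} x≰y with <-tri x y
  ... | inj₁ x<y        = ⊥-elim (x≰y (inj₁ x<y))
  ... | inj₂ (inj₁ x≡y) = ⊥-elim (x≰y (inj₂ x≡y))
  ... | inj₂ (inj₂ y<x) = y<x

  ≮⇒≥ : ∀ {x y} → ¬ x < y → y ≤ x
  ≮⇒≥ {x} {y} x≮y with <-tri x y
  ... | inj₁ x<y        = ⊥-elim (x≮y x<y)
  ... | inj₂ (inj₁ x≡y) = inj₂ (sym x≡y)
  ... | inj₂ (inj₂ y<x) = inj₁ y<x

  +-monoˡ-< : ∀ z {x y} → x < y → x + z < y + z
  +-monoˡ-< z = <-+-compat _ _ z

  +-monoʳ-< : ∀ z {x y} → x < y → z + x < z + y
  +-monoʳ-< z {x} {y} x<y = subst₂ _<_ (+-comm x z) (+-comm y z) (+-monoˡ-< z x<y)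

  +-monoˡ-≤ : ∀ z {x y} → x ≤ y → x + z ≤ y + z
  +-monoˡ-≤ z (inj₁ x<y) = inj₁ (+-monoˡ-< z x<y)
  +-monoˡ-≤ z (inj₂ refl) = ≤-refl

  +-monoʳ-≤ : ∀ z {x y} → x ≤ y → z + x ≤ z + y
  +-monoʳ-≤ z (inj₁ x<y) = inj₁ (+-monoʳ-< z x<y)
  +-monoʳ-≤ z (inj₂ refl) = ≤-refl

  +-mono-≤ : ∀ {x y u v} → x ≤ y → u ≤ v → x + u ≤ y + v
  +-mono-≤ {y = y} {u} x≤y u≤v = ≤-trans (+-monoˡ-≤ u x≤y) (+-monoʳ-≤ y u≤v)

  +-mono-<-≤ : ∀ {x y u v} → x < y → u ≤ v → x + u < y + v
  +-mono-<-≤ {x} {y} {u} {v} x<y u≤v = begin-strict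
    x + u <⟨ +-monoˡ-< u x<y ⟩
    y + u ≤⟨ +-monoʳ-≤ y u≤v ⟩
    y + v ∎
    where open ≤-Reasoning

  +-cancelʳ-< : ∀ z {x y} → x + z < y + z → x < y
  +-cancelʳ-< z {x} {y} lt =
    subst₂ _<_ (//-rightDividesʳ z x) (//-rightDividesʳ z y) (+-monoˡ-< (- z) lt)

  neg-antimono-< : ∀ {x y} → x < y → - y < - x
  neg-antimono-< {x} {y} x<y =
    subst₂ _<_ (\\-leftDividesˡ x (- y)) y-cancel (+-monoˡ-< (- x + - y) x<y)
    where
    y-cancel : y + (- x + - y) ≡ - x
    y-cancel = trans (cong (y +_) (+-comm (- x) (- y))) (\\-leftDividesˡ y (- x))

  neg-antimono-≤ : ∀ {x y} → x ≤ y → - y ≤ - x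
  neg-antimono-≤ (inj₁ x<y) = inj₁ (neg-antimono-< x<y)
  neg-antimono-≤ (inj₂ refl) = ≤-refl

  x≤y⇒x-y≤0 : ∀ {x y} → x ≤ y → x - y ≤ 0#
  x≤y⇒x-y≤0 {y = y} x≤y = subst (_ ≤_) (+-inverseʳ y) (+-monoˡ-≤ (- y) x≤y)

  0≤x⇒-x≤0 : ∀ {x} → 0# ≤ x → - x ≤ 0#
  0≤x⇒-x≤0 0≤x = subst (_ ≤_) -0#≡0# (neg-antimono-≤ 0≤x)

  x<0⇒0<-x : ∀ {x} → x < 0# → 0# < - x
  x<0⇒0<-x x<0 = subst (_< _) -0#≡0# (neg-antimono-< x<0)

  -x≤y⇒-y≤x : ∀ {x y} → - x ≤ y → - y ≤ x
  -x≤y⇒-y≤x {x} -x≤y = subst (_ ≤_) (-‿involutive x) (neg-antimono-≤ -x≤y)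

  -x<y⇒-y<x : ∀ {x y} → - x < y → - y < x
  -x<y⇒-y<x {x} -x<y = subst (_ <_) (-‿involutive x) (neg-antimono-< -x<y)

  -- Absolute value

  ∣x∣-cases : ∀ x → (∣ x ∣ ≡ x × 0# ≤ x) ⊎ (∣ x ∣ ≡ - x × x < 0#)
  ∣x∣-cases x with <-tri 0# x
  ... | inj₁ 0<x        = inj₁ (refl , inj₁ 0<x)
  ... | inj₂ (inj₁ 0≡x) = inj₁ (refl , inj₂ 0≡x)
  ... | inj₂ (inj₂ x<0) = inj₂ (refl , x<0)

  0≤∣x∣ : ∀ x → 0# ≤ ∣ x ∣
  0≤∣x∣ x with ∣x∣-cases x
  ... | inj₁ (∣x∣≡x , 0≤x)  = subst (0# ≤_) (sym ∣x∣≡x) 0≤x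
  ... | inj₂ (∣x∣≡-x , x<0) = subst (0# ≤_) (sym ∣x∣≡-x) (inj₁ (x<0⇒0<-x x<0))

  x≤∣x∣ : ∀ x → x ≤ ∣ x ∣
  x≤∣x∣ x with ∣x∣-cases x
  ... | inj₁ (∣x∣≡x , _)    = inj₂ (sym ∣x∣≡x)
  ... | inj₂ (∣x∣≡-x , x<0) = subst (x ≤_) (sym ∣x∣≡-x) (inj₁ (<-trans _ _ _ x<0 (x<0⇒0<-x x<0)))

  -x≤∣x∣ : ∀ x → - x ≤ ∣ x ∣
  -x≤∣x∣ x with ∣x∣-cases x
  ... | inj₁ (∣x∣≡x , 0≤x) = subst (- x ≤_) (sym ∣x∣≡x) (≤-trans (0≤x⇒-x≤0 0≤x) 0≤x)
  ... | inj₂ (∣x∣≡-x , _)  = inj₂ (sym ∣x∣≡-x)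

  ∣x∣≤-intro : ∀ {x b} → x ≤ b → - x ≤ b → ∣ x ∣ ≤ b
  ∣x∣≤-intro {x} x≤b -x≤b with ∣x∣-cases x
  ... | inj₁ (∣x∣≡x , _)  = subst (_≤ _) (sym ∣x∣≡x) x≤b
  ... | inj₂ (∣x∣≡-x , _) = subst (_≤ _) (sym ∣x∣≡-x) -x≤b

  ∣x∣<-intro : ∀ {x b} → x < b → - x < b → ∣ x ∣ < b
  ∣x∣<-intro {x} x<b -x<b with ∣x∣-cases x
  ... | inj₁ (∣x∣≡x , _)  = subst (_< _) (sym ∣x∣≡x) x<b
  ... | inj₂ (∣x∣≡-x , _) = subst (_< _) (sym ∣x∣≡-x) -x<b

  ∣x∣≤-elim : ∀ {x b} → ∣ x ∣ ≤ b → - b ≤ x × x ≤ b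
  ∣x∣≤-elim {x} ∣x∣≤b = -x≤y⇒-y≤x (≤-trans (-x≤∣x∣ x) ∣x∣≤b) , ≤-trans (x≤∣x∣ x) ∣x∣≤b

  ∣x∣<-elim : ∀ {x b} → ∣ x ∣ < b → - b < x × x < b
  ∣x∣<-elim {x} ∣x∣<b = -x<y⇒-y<x (≤-<-trans (-x≤∣x∣ x) ∣x∣<b) , ≤-<-trans (x≤∣x∣ x) ∣x∣<b

  ∣-x∣≤∣x∣ : ∀ x → ∣ - x ∣ ≤ ∣ x ∣
  ∣-x∣≤∣x∣ x = ∣x∣≤-intro (-x≤∣x∣ x) (subst (_≤ ∣ x ∣) (sym (-‿involutive x)) (x≤∣x∣ x))

  ∣x+y∣≤∣x∣+∣y∣ : ∀ x y → ∣ x + y ∣ ≤ ∣ x ∣ + ∣ y ∣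
  ∣x+y∣≤∣x∣+∣y∣ x y = ∣x∣≤-intro (+-mono-≤ (x≤∣x∣ x) (x≤∣x∣ y))
    (subst (_≤ ∣ x ∣ + ∣ y ∣) (-‿+-comm x y) (+-mono-≤ (-x≤∣x∣ x) (-x≤∣x∣ y)))

  -- Multiples

  •-zeroʳ : ∀ k → k • 0# ≡ 0#
  •-zeroʳ zero    = refl
  •-zeroʳ (suc k) = trans (+-identityˡ (k • 0#)) (•-zeroʳ k)

  •-neg : ∀ k y → k • (- y) ≡ - (k • y)
  •-neg zero    y = sym -0#≡0#
  •-neg (suc k) y = trans (cong (- y +_) (•-neg k y)) (-‿+-comm y (k • y))

  •-homo-+ : ∀ p q y → (p ℕ.+ q) • y ≡ p • y + q • y
  •-homo-+ zero    q y = sym (+-identityˡ (q • y))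
  •-homo-+ (suc p) q y = trans (cong (y +_) (•-homo-+ p q y)) (sym (+-assoc y (p • y) (q • y)))

  •-assocˡ : ∀ n m y → n • (m • y) ≡ (n ℕ.* m) • y
  •-assocˡ zero    m y = refl
  •-assocˡ (suc n) m y = trans (cong (m • y +_) (•-assocˡ n m y)) (sym (•-homo-+ m (n ℕ.* m) y))

  •-monoʳ-≤ : ∀ k {y w} → y ≤ w → k • y ≤ k • w
  •-monoʳ-≤ zero    y≤w = ≤-refl
  •-monoʳ-≤ (suc k) y≤w = +-mono-≤ y≤w (•-monoʳ-≤ k y≤w)

  •-monoʳ-< : ∀ k {y w} → y < w → suc k • y < suc k • w
  •-monoʳ-< k y<w = +-mono-<-≤ y<w (•-monoʳ-≤ k (inj₁ y<w))

  •-cancelʳ-≤ : ∀ k {y w} → suc k • y ≤ suc k • w → y ≤ w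
  •-cancelʳ-≤ k ky≤kw = ≮⇒≥ λ w<y → ≤⇒≯ ky≤kw (•-monoʳ-< k w<y)

  •-monoˡ-≤ : ∀ k {y} → 0# ≤ y → k • y ≤ suc k • y
  •-monoˡ-≤ k {y} 0≤y = subst (_≤ suc k • y) (+-identityˡ (k • y)) (+-monoˡ-≤ (k • y) 0≤y)

  x+suc[k]•y≡x+k•y+y : ∀ x k y → x + suc k • y ≡ (x + k • y) + y
  x+suc[k]•y≡x+k•y+y x k y = trans (cong (x +_) (+-comm y (k • y))) (sym (+-assoc x (k • y) y))

  1•x≡x : ∀ x → 1 • x ≡ x
  1•x≡x = +-identityʳ

  2•x≡x+x : ∀ x → 2 • x ≡ x + x
  2•x≡x+x x = cong (x +_) (+-identityʳ x)

  -- Archimedean valuation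

  ∣∣≤•⇒≼Δ : ∀ {x y} n → ∣ x ∣ ≤ n • ∣ y ∣ → x ≼Δ y
  ∣∣≤•⇒≼Δ n ∣x∣≤n∣y∣ = n , ∣x∣≤-elim ∣x∣≤n∣y∣

  ≼Δ⇒∣∣≤• : ∀ {x y} (x≼y : x ≼Δ y) → ∣ x ∣ ≤ proj₁ x≼y • ∣ y ∣
  ≼Δ⇒∣∣≤• (n , -n∣y∣≤x , x≤n∣y∣) = ∣x∣≤-intro x≤n∣y∣ (-x≤y⇒-y≤x -n∣y∣≤x)

  ≈Δ-refl : ∀ x → x ≈Δ x
  ≈Δ-refl x = x≼x , x≼x
    where
    x≼x : x ≼Δ x
    x≼x = ∣∣≤•⇒≼Δ 1 (inj₂ (sym (1•x≡x ∣ x ∣)))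

  ≈Δ-perturb : ∀ t s → 2 • ∣ t ∣ < ∣ t + s ∣ → s ≈Δ (t + s)
  ≈Δ-perturb t s 2∣t∣<∣t+s∣ = ∣∣≤•⇒≼Δ 2 ∣s∣≤2∣t+s∣ , ∣∣≤•⇒≼Δ 2 ∣t+s∣≤2∣s∣
    where
    open ≤-Reasoning
    ∣t∣<∣s∣ : ∣ t ∣ < ∣ s ∣
    ∣t∣<∣s∣ = +-cancelʳ-< ∣ t ∣ (begin-strict
      ∣ t ∣ + ∣ t ∣ ≡⟨ 2•x≡x+x ∣ t ∣ ⟨
      2 • ∣ t ∣     <⟨ 2∣t∣<∣t+s∣ ⟩
      ∣ t + s ∣     ≤⟨ ∣x+y∣≤∣x∣+∣y∣ t s ⟩
      ∣ t ∣ + ∣ s ∣ ≡⟨ +-comm ∣ t ∣ ∣ s ∣ ⟩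
      ∣ s ∣ + ∣ t ∣ ∎)
    ∣t∣≤∣t+s∣ : ∣ t ∣ ≤ ∣ t + s ∣
    ∣t∣≤∣t+s∣ = begin
      ∣ t ∣     ≡⟨ 1•x≡x ∣ t ∣ ⟨
      1 • ∣ t ∣ ≤⟨ •-monoˡ-≤ 1 (0≤∣x∣ t) ⟩
      2 • ∣ t ∣ <⟨ 2∣t∣<∣t+s∣ ⟩
      ∣ t + s ∣ ∎
    ∣t+s∣≤2∣s∣ : ∣ t + s ∣ ≤ 2 • ∣ s ∣
    ∣t+s∣≤2∣s∣ = begin
      ∣ t + s ∣     ≤⟨ ∣x+y∣≤∣x∣+∣y∣ t s ⟩
      ∣ t ∣ + ∣ s ∣ ≤⟨ +-monoˡ-≤ ∣ s ∣ (inj₁ ∣t∣<∣s∣) ⟩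
      ∣ s ∣ + ∣ s ∣ ≡⟨ 2•x≡x+x ∣ s ∣ ⟨
      2 • ∣ s ∣     ∎
    ∣s∣≤2∣t+s∣ : ∣ s ∣ ≤ 2 • ∣ t + s ∣
    ∣s∣≤2∣t+s∣ = begin
      ∣ s ∣                 ≡⟨ cong ∣_∣ (\\-leftDividesʳ t s) ⟨
      ∣ - t + (t + s) ∣     ≤⟨ ∣x+y∣≤∣x∣+∣y∣ (- t) (t + s) ⟩
      ∣ - t ∣ + ∣ t + s ∣   ≤⟨ +-monoˡ-≤ ∣ t + s ∣ (≤-trans (∣-x∣≤∣x∣ t) ∣t∣≤∣t+s∣) ⟩
      ∣ t + s ∣ + ∣ t + s ∣ ≡⟨ 2•x≡x+x ∣ t + s ∣ ⟨
      2 • ∣ t + s ∣         ∎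

  Between : Carrier → Carrier → Carrier → Set
  Between p q c = (p ≤ c × c ≤ q) ⊎ (q ≤ c × c ≤ p)

  ∣-∣-between : ∀ {p q c} → Between p q c → ∣ p - c ∣ ≤ ∣ p - q ∣
  ∣-∣-between {p} {q} {c} (inj₁ (p≤c , c≤q)) =
    ∣x∣≤-intro (≤-trans (x≤y⇒x-y≤0 p≤c) (0≤∣x∣ (p - q))) (begin
      - (p - c) ≡⟨ -‿anti-homo‿- p c ⟩
      c - p     ≤⟨ +-monoˡ-≤ (- p) c≤q ⟩
      q - p     ≡⟨ -‿anti-homo‿- p q ⟨
      - (p - q) ≤⟨ -x≤∣x∣ (p - q) ⟩
      ∣ p - q ∣ ∎)
    where open ≤-Reasoning
  ∣-∣-between {p} {q} {c} (inj₂ (q≤c , c≤p)) =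
    ∣x∣≤-intro (≤-trans (+-monoʳ-≤ p (neg-antimono-≤ q≤c)) (x≤∣x∣ (p - q))) (begin
      - (p - c) ≡⟨ -‿anti-homo‿- p c ⟩
      c - p     ≤⟨ x≤y⇒x-y≤0 c≤p ⟩
      0#        ≤⟨ 0≤∣x∣ (p - q) ⟩
      ∣ p - q ∣ ∎)
    where open ≤-Reasoning

module Cuts (M : DOAG) (A : DOAG.Carrier M → Set) where
  open DOAG M
  open DOAGDefs M
  open DOAGProperties M

  ∈I-transfer : ∀ {p q} → ¬ A p → ¬ A q → (∀ c → A c → ¬ Between p q c) →
                (I : Interval A) → p ∈I I → q ∈I I
  ∈I-transfer {p} {q} p∉A q∉A no-A-between (l , u) (p-above-l , p-below-u) =
    above {l} p-above-l , below {u} p-below-u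
    where
    above : ∀ {l : LowerEnd A} → aboveLo l p → aboveLo l q
    above { -∞} _ = tt
    above {open-lo c c∈A} c<p with <-tri c q
    ... | inj₁ c<q        = c<q
    ... | inj₂ (inj₁ c≡q) = ⊥-elim (q∉A (subst A c≡q c∈A))
    ... | inj₂ (inj₂ q<c) = ⊥-elim (no-A-between c c∈A (inj₂ (inj₁ q<c , inj₁ c<p)))
    above {closed-lo c c∈A} (inj₁ c<p) = inj₁ (above {open-lo c c∈A} c<p)
    above {closed-lo c c∈A} (inj₂ c≡p) = ⊥-elim (p∉A (subst A c≡p c∈A))
    below : ∀ {u : UpperEnd A} → belowHi u p → belowHi u q
    below {+∞} _ = tt
    below {open-hi c c∈A} p<c with <-tri q c
    ... | inj₁ q<c        = q<c
    ... | inj₂ (inj₁ q≡c) = ⊥-elim (q∉A (subst A (sym q≡c) c∈A))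
    ... | inj₂ (inj₂ c<q) = ⊥-elim (no-A-between c c∈A (inj₁ (inj₁ p<c , inj₁ c<q)))
    below {closed-hi c c∈A} (inj₁ p<c) = inj₁ (below {open-hi c c∈A} p<c)
    below {closed-hi c c∈A} (inj₂ p≡c) = ⊥-elim (p∉A (subst A (sym p≡c) c∈A))

  ct-≐ : ∀ {p q} → ¬ A p → ¬ A q → (∀ c → A c → ¬ Between p q c) → ct p A ≐ ct q A
  ct-≐ {p} {q} p∉A q∉A no-A-between x = mk⇔
    (λ x∈ct[p] I q∈I → x∈ct[p] I (∈I-transfer q∉A p∉A no-A-between′ I q∈I))
    (λ x∈ct[q] I p∈I → x∈ct[q] I (∈I-transfer p∉A q∉A no-A-between I p∈I))
    where
    no-A-between′ : ∀ c → A c → ¬ Between q p c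
    no-A-between′ c c∈A = no-A-between c c∈A ∘ ⊎-swap

  -- d + x lies in its own cut ct(d + x/A), which is ct(d/A).
  Stab⇒∈I : ∀ {d x} → Stab d A x → (I : Interval A) → d ∈I I → (d + x) ∈I I
  Stab⇒∈I {d} {x} (_ , ct≐) = Equivalence.to (ct≐ (d + x)) (λ _ d+x∈I → d+x∈I)

module Subspace (M : DOAG) {A : DOAG.Carrier M → Set} (A-sub : DOAGDefs.IsQSubspace M A) where
  open DOAG M
  open DOAGDefs M
  open DOAGProperties M
  open Cuts M A
  open IsQSubspace A-sub

  sub-mem : ∀ {x y} → A x → A y → A (x - y)
  sub-mem x∈A y∈A = +-mem _ _ x∈A (neg-mem _ y∈A)

  abs-mem : ∀ {x} → A x → A ∣ x ∣
  abs-mem {x} x∈A with ∣x∣-cases x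
  ... | inj₁ (∣x∣≡x , _)  = subst A (sym ∣x∣≡x) x∈A
  ... | inj₂ (∣x∣≡-x , _) = subst A (sym ∣x∣≡-x) (neg-mem x x∈A)

  •-mem : ∀ k {y} → A y → A (k • y)
  •-mem zero    y∈A = zero-mem
  •-mem (suc k) y∈A = +-mem _ _ y∈A (•-mem k y∈A)

  record ArchimedeanUnit (e : Carrier) : Set where
    field
      unit           : Carrier
      unit∈A         : A unit
      0≤unit         : 0# ≤ unit
      unit≤∣e∣       : unit ≤ ∣ e ∣
      bound          : ℕ
      ∣e∣≤bound•unit : ∣ e ∣ ≤ bound • unit

  ≈Δ⇒archimedeanUnit : ∀ {e b} → A b → e ≈Δ b → ArchimedeanUnit e
  ≈Δ⇒archimedeanUnit {e} {b} b∈A (e≼b , b≼e) = record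
    { unit           = y
    ; unit∈A         = div-mem m y (subst A (sym [1+m]y≡∣b∣) (abs-mem b∈A))
    ; 0≤unit         = ≮⇒≥ y≮0
    ; unit≤∣e∣       = •-cancelʳ-≤ m (begin
        suc m • y     ≡⟨ [1+m]y≡∣b∣ ⟩
        ∣ b ∣         ≤⟨ ≼Δ⇒∣∣≤• b≼e ⟩
        m • ∣ e ∣     ≤⟨ •-monoˡ-≤ m (0≤∣x∣ e) ⟩
        suc m • ∣ e ∣ ∎)
    ; bound          = n ℕ.* suc m
    ; ∣e∣≤bound•unit = begin
        ∣ e ∣               ≤⟨ ≼Δ⇒∣∣≤• e≼b ⟩
        n • ∣ b ∣           ≡⟨ cong (n •_) [1+m]y≡∣b∣ ⟨
        n • (suc m • y)     ≡⟨ •-assocˡ n (suc m) y ⟩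
        (n ℕ.* suc m) • y   ∎
    }
    where
    open ≤-Reasoning
    m = proj₁ b≼e
    n = proj₁ e≼b
    y = proj₁ (divisible m ∣ b ∣)
    [1+m]y≡∣b∣ : suc m • y ≡ ∣ b ∣
    [1+m]y≡∣b∣ = proj₂ (divisible m ∣ b ∣)
    y≮0 : ¬ y < 0#
    y≮0 y<0 = ≤⇒≯ (0≤∣x∣ b) (begin-strict
      ∣ b ∣     ≡⟨ [1+m]y≡∣b∣ ⟨
      suc m • y <⟨ •-monoʳ-< m y<0 ⟩
      suc m • 0# ≡⟨ •-zeroʳ (suc m) ⟩
      0#        ∎)

  stab-lower : ∀ {d y c} → Stab d A (- y) → A c → c ≤ d → c + y ≤ d
  stab-lower {d} {y} {c} S c∈A c≤d =
    subst (c + y ≤_) (//-rightDividesˡ y d)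
      (+-monoˡ-≤ y (proj₁ (Stab⇒∈I S (closed-lo c c∈A , +∞) (c≤d , tt))))

  stab-upper : ∀ {d y c} → Stab d A y → A c → d ≤ c → d ≤ c - y
  stab-upper {d} {y} {c} S c∈A d≤c =
    subst (_≤ c - y) (//-rightDividesʳ y d)
      (+-monoˡ-≤ (- y) (proj₂ (Stab⇒∈I S (-∞ , closed-hi c c∈A) (tt , d≤c))))

  stab-lower-iterate : ∀ {d y c} → Stab d A (- y) → A y → A c → c ≤ d →
                       ∀ k → c + k • y ≤ d
  stab-lower-iterate {d} {y} {c} S y∈A c∈A c≤d zero = subst (_≤ d) (sym (+-identityʳ c)) c≤d
  stab-lower-iterate {d} {y} {c} S y∈A c∈A c≤d (suc k) =
    subst (_≤ d) (sym (x+suc[k]•y≡x+k•y+y c k y))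
      (stab-lower S (+-mem _ _ c∈A (•-mem k y∈A)) (stab-lower-iterate S y∈A c∈A c≤d k))

  stab-upper-iterate : ∀ {d y c} → Stab d A y → A y → A c → d ≤ c →
                       ∀ k → d ≤ c + k • (- y)
  stab-upper-iterate {d} {y} {c} S y∈A c∈A d≤c zero = subst (d ≤_) (sym (+-identityʳ c)) d≤c
  stab-upper-iterate {d} {y} {c} S y∈A c∈A d≤c (suc k) =
    subst (d ≤_) (sym (x+suc[k]•y≡x+k•y+y c k (- y)))
      (stab-upper S (+-mem _ _ c∈A (•-mem k (neg-mem y y∈A))) (stab-upper-iterate S y∈A c∈A d≤c k))

module Theorem (M : DOAG) {A : DOAG.Carrier M → Set} (A-sub : DOAGDefs.IsQSubspace M A)
               {a : DOAG.Carrier M} (a∈A : A a) (d : DOAG.Carrier M) where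
  open DOAG M
  open DOAGDefs M
  open DOAGProperties M
  open Cuts M A
  open Subspace M A-sub
  open IsQSubspace A-sub

  e : Carrier
  e = d - a

  ∉Δ⇒∉A : ¬ Δ∈Δ e A → ¬ A d
  ∉Δ⇒∉A e∉Δ[A] d∈A = e∉Δ[A] (e , sub-mem d∈A a∈A , ≈Δ-refl e)

  ∉Δ⇒2∣x∣<∣e∣ : ∀ {x} → ¬ Δ∈Δ e A → A x → ∣ x ∣ ≤ ∣ e ∣ → 2 • ∣ x ∣ < ∣ e ∣
  ∉Δ⇒2∣x∣<∣e∣ {x} e∉Δ[A] x∈A ∣x∣≤∣e∣ = ≰⇒> λ ∣e∣≤2∣x∣ →
    e∉Δ[A] (x , x∈A , ∣∣≤•⇒≼Δ 2 ∣e∣≤2∣x∣ , ∣∣≤•⇒≼Δ 1 (subst (∣ x ∣ ≤_) (sym (1•x≡x ∣ e ∣)) ∣x∣≤∣e∣))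

  close⇒Δ∈Δ : ∀ {c} → A c → 2 • ∣ d - c ∣ < ∣ e ∣ → Δ∈Δ e A
  close⇒Δ∈Δ {c} c∈A 2∣d-c∣<∣e∣ =
    c - a , sub-mem c∈A a∈A , swap (subst ((c - a) ≈Δ_) [d-c]+[c-a]≡e
      (≈Δ-perturb (d - c) (c - a)
        (subst (λ z → 2 • ∣ d - c ∣ < ∣ z ∣) (sym [d-c]+[c-a]≡e) 2∣d-c∣<∣e∣)))
    where
    [d-c]+[c-a]≡e : (d - c) + (c - a) ≡ e
    [d-c]+[c-a]≡e = [x-y]+[y-z]≡x-z d c a

  ∉Δ⇒Stab : ∀ {x} → ¬ Δ∈Δ e A → A x → ∣ x ∣ ≤ ∣ e ∣ → Stab d A x
  ∉Δ⇒Stab {x} e∉Δ[A] x∈A ∣x∣≤∣e∣ = x∈A , ct-≐ d+x∉A d∉A no-A-between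
    where
    d∉A = ∉Δ⇒∉A e∉Δ[A]
    d+x∉A : ¬ A (d + x)
    d+x∉A d+x∈A = d∉A (subst A (//-rightDividesʳ x d) (sub-mem d+x∈A x∈A))
    no-A-between : ∀ c → A c → ¬ Between (d + x) d c
    no-A-between c c∈A c-between = e∉Δ[A] (close⇒Δ∈Δ c∈A (begin-strict
      2 • ∣ d - c ∣       ≤⟨ •-monoʳ-≤ 2 (∣-∣-between (⊎-swap c-between)) ⟩
      2 • ∣ d - (d + x) ∣ ≡⟨ cong (λ z → 2 • ∣ z ∣) (x-[x+y]≡-y d x) ⟩
      2 • ∣ - x ∣         ≤⟨ •-monoʳ-≤ 2 (∣-x∣≤∣x∣ x) ⟩
      2 • ∣ x ∣           <⟨ ∉Δ⇒2∣x∣<∣e∣ e∉Δ[A] x∈A ∣x∣≤∣e∣ ⟩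
      ∣ e ∣               ∎))
      where open ≤-Reasoning

  ∉Δ⇒∈G : ¬ Δ∈Δ e A → G d A e
  ∉Δ⇒∈G e∉Δ[A] = (λ d∈A → ⊥-elim (∉Δ⇒∉A e∉Δ[A] d∈A)) , λ _ x x∈A x∉Stab →
    ∣x∣<-elim (≰⇒> λ ∣x∣≤∣e∣ → x∉Stab (∉Δ⇒Stab e∉Δ[A] x∈A ∣x∣≤∣e∣))

  ∈G⇒¬¬Stab : ∀ {x} → G d A e → ¬ A d → A x → ∣ x ∣ ≤ ∣ e ∣ → ¬ ¬ Stab d A x
  ∈G⇒¬¬Stab {x} (_ , bounds) d∉A x∈A ∣x∣≤∣e∣ x∉Stab =
    ≤⇒≯ ∣x∣≤∣e∣ (∣x∣<-intro e<∣x∣ (-x<y⇒-y<x -∣x∣<e))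
    where
    -∣x∣<e = proj₁ (bounds d∉A x x∈A x∉Stab)
    e<∣x∣  = proj₂ (bounds d∉A x x∈A x∉Stab)

  module _ (e∈G : G d A e) (d∉A : ¬ A d) (u : ArchimedeanUnit e) where
    open ArchimedeanUnit u renaming (unit to y; unit∈A to y∈A; bound to K)
    open ≤-Reasoning

    ∣±y∣≤∣e∣ : ∣ y ∣ ≤ ∣ e ∣ × ∣ - y ∣ ≤ ∣ e ∣
    ∣±y∣≤∣e∣ = ∣y∣≤∣e∣ , ≤-trans (∣-x∣≤∣x∣ y) ∣y∣≤∣e∣
      where
      ∣y∣≤∣e∣ = ∣x∣≤-intro unit≤∣e∣ (≤-trans (0≤x⇒-x≤0 0≤unit) (0≤∣x∣ e))

    positive-absurd : 0# < e → ⊥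
    positive-absurd 0<e = ∈G⇒¬¬Stab e∈G d∉A (neg-mem y y∈A) (proj₂ ∣±y∣≤∣e∣) λ S →
      d∉A (subst A (≤-antisym (stab-lower-iterate S y∈A a∈A a≤d K) d≤a+Ky)
                   (+-mem _ _ a∈A (•-mem K y∈A)))
      where
      a≤d : a ≤ d
      a≤d = inj₁ (begin-strict
        a      ≡⟨ +-identityʳ a ⟨
        a + 0# <⟨ +-monoʳ-< a 0<e ⟩
        a + e  ≡⟨ x+[y-x]≡y a d ⟩
        d      ∎)
      d≤a+Ky : d ≤ a + K • y
      d≤a+Ky = begin
        d         ≡⟨ x+[y-x]≡y a d ⟨
        a + e     ≤⟨ +-monoʳ-≤ a (≤-trans (x≤∣x∣ e) ∣e∣≤bound•unit) ⟩
        a + K • y ∎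

    negative-absurd : e < 0# → ⊥
    negative-absurd e<0 = ∈G⇒¬¬Stab e∈G d∉A y∈A (proj₁ ∣±y∣≤∣e∣) λ S →
      d∉A (subst A (sym (≤-antisym (stab-upper-iterate S y∈A a∈A d≤a K) a-Ky≤d))
                   (+-mem _ _ a∈A (•-mem K (neg-mem y y∈A))))
      where
      d≤a : d ≤ a
      d≤a = inj₁ (begin-strict
        d      ≡⟨ x+[y-x]≡y a d ⟨
        a + e  <⟨ +-monoʳ-< a e<0 ⟩
        a + 0# ≡⟨ +-identityʳ a ⟩
        a      ∎)
      a-Ky≤d : a + K • (- y) ≤ d
      a-Ky≤d = begin
        a + K • (- y) ≡⟨ cong (a +_) (•-neg K y) ⟩
        a - K • y     ≤⟨ +-monoʳ-≤ a (-x≤y⇒-y≤x (≤-trans (-x≤∣x∣ e) ∣e∣≤bound•unit)) ⟩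
        a + e         ≡⟨ x+[y-x]≡y a d ⟩
        d             ∎

  ∈G⇒∉Δ : G d A e → ¬ A d → ¬ Δ∈Δ e A
  ∈G⇒∉Δ e∈G d∉A (b , b∈A , e≈b) = by-sign (<-tri 0# e)
    where
    u = ≈Δ⇒archimedeanUnit b∈A e≈b
    by-sign : (0# < e) ⊎ (0# ≡ e) ⊎ (e < 0#) → ⊥
    by-sign (inj₁ 0<e)        = positive-absurd e∈G d∉A u 0<e
    by-sign (inj₂ (inj₂ e<0)) = negative-absurd e∈G d∉A u e<0
    by-sign (inj₂ (inj₁ 0≡e)) = d∉A (subst A a≡d a∈A)
      where
      a≡d : a ≡ d
      a≡d = begin
        a      ≡⟨ +-identityʳ a ⟨
        a + 0# ≡⟨ cong (a +_) 0≡e ⟩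
        a + e  ≡⟨ x+[y-x]≡y a d ⟩
        d      ∎
        where open ≡-Reasoning

mainTheorem10 : (M : DOAG) (A : DOAG.Carrier M → Set) →
    DOAGDefs.IsQSubspace M A →
    DOAGDefs.Saturated⁺ M A →
    DOAGDefs.StronglyHomogeneous⁺ M A →
    (a : DOAG.Carrier M) → A a → (d : DOAG.Carrier M) →
    ((DOAGDefs.G M d A (DOAGDefs._-_ M d a) × ¬ A d)
      ⇔ (¬ DOAGDefs.Δ∈Δ M (DOAGDefs._-_ M d a) A))
mainTheorem10 M A A-sub _ _ a a∈A d = mk⇔
  (λ (e∈G , d∉A) → ∈G⇒∉Δ e∈G d∉A)
  (λ e∉Δ[A] → ∉Δ⇒∈G e∉Δ[A] , ∉Δ⇒∉A e∉Δ[A])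
  where open Theorem M A-sub a∈A d
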